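{- Let $k \in \mathbb{Z}$ and $n,m\in\mathbb{Z}^+$ with $n\geq 2$, $k\not\equiv 0\pmod n$, and $m\geq 2$, and let $K_m$ be the complete graph on $m$ vertices. Then $\chi_{(n,k)}(K_m) = m$ if $(m-1,n)\mid k$, and $\chi_{(n,k)}(K_m)$ does not exist otherwise.
   Context: $(a,b)$ denotes the greatest common divisor. For a graph $G=(V,E)$, a $\mathbb{Z}$-labeling is a map $\ell:V\to\mathbb{Z}$; its order is the size of its range; it is proper if adjacent vertices get different labels. $N(v)$ is the open neighborhood of $v$. An open coloring with remainder $k \bmod n$ is a labeling with $\sum_{w\in N(v)}\ell(w)\equiv k \pmod n$ for all $v\in V$. If no proper such coloring exists, $\chi_{(n,k)}(G)$ does not exist; otherwise $\chi_{(n,k)}(G)$ is the minimum order of a proper open coloring with remainder $k\bmod n$. -}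

module Defs where

open import Data.Nat as ℕ using (ℕ; suc; _∸_)
open import Data.Nat.GCD using (gcd)
open import Data.Integer as ℤ using (ℤ; +_; _-_)
open import Data.Integer.Divisibility using (_∣_)
open import Data.Fin using (Fin)
open import Data.Fin.Properties using () renaming (_≟_ to _≟ᶠ_)
open import Data.List using (List; map; sum; length; deduplicate; allFin)
open import Data.Product using (Σ; _×_; _,_)
open import Relation.Nullary using (¬_; Dec; yes; no)
open import Relation.Binary.PropositionalEquality using (_≡_)
open import Level using (0ℓ)

record Graph : Set₁ where
  field
    V      : ℕ
    Adj    : Fin V → Fin V → Set
    Adj?   : (v w : Fin V) → Dec (Adj v w)
    irrefl : ∀ v → ¬ Adj v v
    sym    : ∀ v w → Adj v w → Adj w v
open Graph public

K : ℕ → Graph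
K m = record
  { V = m
  ; Adj = λ v w → ¬ (v ≡ w)
  ; Adj? = λ v w → dec v w
  ; irrefl = λ v p → p Relation.Binary.PropositionalEquality.refl
  ; sym = λ v w p q → p (Relation.Binary.PropositionalEquality.sym q)
  }
  where
  dec : (v w : Fin m) → Dec (¬ (v ≡ w))
  dec v w with v ≟ᶠ w
  ... | yes e = no (λ f → f e)
  ... | no ne = yes ne

Labeling : Graph → Set
Labeling G = Fin (V G) → ℤ

order : (G : Graph) → Labeling G → ℕ
order G ℓ = length (deduplicate ℤ._≟_ (map ℓ (allFin (V G))))

Proper : (G : Graph) → Labeling G → Set
Proper G ℓ = ∀ v w → Adj G v w → ¬ (ℓ v ≡ ℓ w)

nbSum : (G : Graph) → Labeling G → Fin (V G) → ℤ
nbSum G ℓ v = sumℤ (map f (allFin (V G)))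
  where
  f : Fin (V G) → ℤ
  f w with Adj? G v w
  ... | yes _ = ℓ w
  ... | no _  = + 0
  sumℤ : List ℤ → ℤ
  sumℤ = Data.List.foldr ℤ._+_ (+ 0)

_≡_[mod_] : ℤ → ℤ → ℕ → Set
a ≡ b [mod n ] = (+ n) ∣ (a - b)

OpenColoring : (n : ℕ) (k : ℤ) (G : Graph) → Labeling G → Set
OpenColoring n k G ℓ = ∀ v → nbSum G ℓ v ≡ k [mod n ]

ProperOpen : (n : ℕ) (k : ℤ) (G : Graph) → Labeling G → Set
ProperOpen n k G ℓ = Proper G ℓ × OpenColoring n k G ℓ

χExists : ℕ → ℤ → Graph → Set
χExists n k G = Σ (Labeling G) (ProperOpen n k G)

χ≡ : ℕ → ℤ → Graph → ℕ → Set
χ≡ n k G c =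
  Σ (Labeling G) (λ ℓ → ProperOpen n k G ℓ × order G ℓ ≡ c)
  × (∀ ℓ → ProperOpen n k G ℓ → c ℕ.≤ order G ℓ)

-- In K_m the neighbourhood sum of v is S − ℓ(v), where S is the sum of all labels.
-- So an open colouring with remainder k has all its labels congruent to a single c
-- modulo n, and then (m − 1)c ≡ S − c ≡ k (mod n). Conversely, if (m − 1)c ≡ k, the
-- progression c, c + n, c + 2n, … is a proper open colouring. Such a c exists iff
-- gcd(m − 1, n) ∣ k (Bézout), and a proper labelling of K_m is injective, so every
-- proper open colouring has order exactly m.
{-# OPTIONS --safe #-}
module Submission where

open import Defs
open import Data.Nat using (ℕ; _≤_; _∸_)
open import Data.Nat.GCD using (gcd)
open import Data.Integer using (ℤ; +_)
open import Data.Integer.Divisibility using (_∣_)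
open import Relation.Nullary using (¬_)
open import Data.Product using (_×_)

open import Algebra.Bundles using (CommutativeMonoid)
import Algebra.Properties.CommutativeMonoid.Sum as MonoidSum
open import Data.Empty using (⊥-elim)
open import Data.Fin using (Fin; zero; suc; toℕ; punchIn)
open import Data.Fin.Properties using (punchInᵢ≢i; toℕ-injective) renaming (_≟_ to _≟ᶠ_)
open import Data.Integer using (_+_; _-_; _*_; -_)
import Data.Integer.Properties as ℤ
import Data.Integer.Divisibility.Signed as Signed
open import Data.Integer.Tactic.RingSolver using (solve-∀)
open import Data.List using (List; []; _∷_; map; tabulate; length; deduplicate; allFin)
import Data.List as List
open import Data.List.Properties using (filter-all; map-tabulate; length-map; length-tabulate)
open import Data.List.Relation.Unary.AllPairs using ([]; _∷_)
open import Data.List.Relation.Unary.Unique.Propositional using (Unique)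
open import Data.List.Relation.Unary.Unique.Propositional.Properties using (map⁺; allFin⁺)
import Data.Nat as ℕ
open import Data.Nat.Properties using (≤-reflexive)
import Data.Nat.GCD as ℕ
open import Data.Product using (∃-syntax; _,_; proj₁; proj₂)
open import Data.Vec.Functional using (Vector; removeAt)
import Data.Vec.Functional as Vector
open import Function using (_∘_; id)
open import Function.Definitions using (Injective)
open import Level using (0ℓ)
open import Relation.Binary.Bundles using (Setoid)
open import Relation.Binary.Definitions using (DecidableEquality)
open import Relation.Binary.PropositionalEquality
  using (_≡_; _≢_; refl; trans; cong; subst; module ≡-Reasoning)
import Relation.Binary.PropositionalEquality as ≡
open import Relation.Nullary using (yes; no; ¬?)
open import Relation.Nullary.Decidable using (decidable-stable)

open import Algebra.Properties.AbelianGroup ℤ.+-0-abelianGroup using (∙-cancelˡ; ⁻¹-anti-homo‿-; xyx⁻¹≈y)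

module _ {c ℓ} (M : CommutativeMonoid c ℓ) where
  open CommutativeMonoid M
  open MonoidSum M using (sum; sum-remove; sum-cong-≋)
  open import Relation.Binary.Reasoning.Setoid setoid

  sum-punctured : ∀ {m} (f g : Vector Carrier (ℕ.suc m)) i → g i ≈ ε → (∀ j → i ≢ j → g j ≈ f j) →
                  f i ∙ sum g ≈ sum f
  sum-punctured f g i gᵢ≈ε g≈f = begin
    f i ∙ sum g                       ≈⟨ ∙-congˡ (sum-remove {i = i} g) ⟩
    f i ∙ (g i ∙ sum (removeAt g i))  ≈⟨ ∙-congˡ (∙-cong gᵢ≈ε (sum-cong-≋ g≈f∘punchIn)) ⟩
    f i ∙ (ε ∙ sum (removeAt f i))    ≈⟨ ∙-congˡ (identityˡ _) ⟩
    f i ∙ sum (removeAt f i)          ≈⟨ sum-remove {i = i} f ⟨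
    sum f                             ∎
    where
    g≈f∘punchIn : ∀ j → g (punchIn i j) ≈ f (punchIn i j)
    g≈f∘punchIn j = g≈f (punchIn i j) (punchInᵢ≢i i j ∘ ≡.sym)

foldr-tabulate : ∀ {a b} {A : Set a} {B : Set b} (_∙_ : A → B → B) (e : B) {m} (f : Fin m → A) →
                 List.foldr _∙_ e (tabulate f) ≡ Vector.foldr _∙_ e f
foldr-tabulate _∙_ e {ℕ.zero}  f = refl
foldr-tabulate _∙_ e {ℕ.suc m} f = cong (f zero ∙_) (foldr-tabulate _∙_ e (f ∘ suc))

open MonoidSum ℤ.+-0-commutativeMonoid using (sum)

private
  variable
    a b c d k : ℤ
    n : ℕ

-- a ≡ b [mod n] unfolds to a divisibility of absolute values, from which Agda cannot
-- recover a and b; this is why the integers are often passed explicitly below.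
≡-mod⇒∣ : ∀ a b → a ≡ b [mod n ] → + n Signed.∣ a - b
≡-mod⇒∣ _ _ = Signed.∣ᵤ⇒∣

∣⇒≡-mod : ∀ a b → + n Signed.∣ a - b → a ≡ b [mod n ]
∣⇒≡-mod _ _ = Signed.∣⇒∣ᵤ

≡-mod-refl : ∀ a → a ≡ a [mod n ]
≡-mod-refl a = ∣⇒≡-mod a a (Signed.divides (+ 0) (ℤ.+-inverseʳ a))

≡-mod-sym : a ≡ b [mod n ] → b ≡ a [mod n ]
≡-mod-sym {a = a} {b = b} a≡b =
  ∣⇒≡-mod b a (subst (_ Signed.∣_) (⁻¹-anti-homo‿- a b) (Signed.∣m⇒∣-m (≡-mod⇒∣ a b a≡b)))

≡-mod-trans : a ≡ b [mod n ] → b ≡ c [mod n ] → a ≡ c [mod n ]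
≡-mod-trans {a = a} {b = b} {c = c} a≡b b≡c =
  ∣⇒≡-mod a c (subst (_ Signed.∣_) (telescope a b c)
    (Signed.∣m∣n⇒∣m+n (≡-mod⇒∣ a b a≡b) (≡-mod⇒∣ b c b≡c)))
  where
  telescope : ∀ a b c → (a - b) + (b - c) ≡ a - c
  telescope = solve-∀

≡-mod-setoid : ℕ → Setoid 0ℓ 0ℓ
≡-mod-setoid n = record
  { Carrier       = ℤ
  ; _≈_           = _≡_[mod n ]
  ; isEquivalence = record
    { refl  = λ {a} → ≡-mod-refl a
    ; sym   = λ {a b} → ≡-mod-sym {a = a} {b = b}
    ; trans = λ {a b c} → ≡-mod-trans {a = a} {b = b} {c = c}
    }
  }

module ≡-mod-Reasoning (n : ℕ) where
  open import Relation.Binary.Reasoning.Setoid (≡-mod-setoid n) public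

+-cong-mod : a ≡ b [mod n ] → c ≡ d [mod n ] → (a + c) ≡ (b + d) [mod n ]
+-cong-mod {a = a} {b = b} {c = c} {d = d} a≡b c≡d =
  ∣⇒≡-mod (a + c) (b + d) (subst (_ Signed.∣_) (interchange a b c d)
    (Signed.∣m∣n⇒∣m+n (≡-mod⇒∣ a b a≡b) (≡-mod⇒∣ c d c≡d)))
  where
  interchange : ∀ a b c d → (a - b) + (c - d) ≡ (a + c) - (b + d)
  interchange = solve-∀

minus-cong-mod : a ≡ b [mod n ] → c ≡ d [mod n ] → (a - c) ≡ (b - d) [mod n ]
minus-cong-mod {a = a} {b = b} {c = c} {d = d} a≡b c≡d =
  ∣⇒≡-mod (a - c) (b - d) (subst (_ Signed.∣_) (interchange a b c d)
    (Signed.∣m∣n⇒∣m-n (≡-mod⇒∣ a b a≡b) (≡-mod⇒∣ c d c≡d)))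
  where
  interchange : ∀ a b c d → (a - b) - (c - d) ≡ (a - c) - (b - d)
  interchange = solve-∀

*-congʳ-mod : ∀ c → a ≡ b [mod n ] → (a * c) ≡ (b * c) [mod n ]
*-congʳ-mod {a = a} {b = b} c a≡b =
  ∣⇒≡-mod (a * c) (b * c) (subst (_ Signed.∣_) (distrib a b c) (Signed.∣m⇒∣m*n c (≡-mod⇒∣ a b a≡b)))
  where
  distrib : ∀ a b c → (a - b) * c ≡ a * c - b * c
  distrib = solve-∀

+-multiple-mod : ∀ a q → (a + q * + n) ≡ a [mod n ]
+-multiple-mod {n = n} a q = ∣⇒≡-mod (a + q * + n) a (Signed.divides q (xyx⁻¹≈y a _))

sum-const : ∀ m c → sum {m} (λ _ → c) ≡ + m * c
sum-const ℕ.zero    c = refl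
sum-const (ℕ.suc m) c = trans (cong (λ s → c + s) (sum-const m c)) (≡.sym (ℤ.suc-* (+ m) c))

sum-cong-mod : ∀ {m} {f g : Fin m → ℤ} → (∀ i → f i ≡ g i [mod n ]) → sum f ≡ sum g [mod n ]
sum-cong-mod {m = ℕ.zero}  _   = ≡-mod-refl (+ 0)
sum-cong-mod {m = ℕ.suc m} {f} {g} f≡g =
  +-cong-mod {a = f zero} {b = g zero} {c = sum (f ∘ suc)} {d = sum (g ∘ suc)}
    (f≡g zero) (sum-cong-mod (f≡g ∘ suc))

nbSum-summand : (G : Graph) (ℓ : Labeling G) (v : Fin (V G)) →
  ∃[ F ] nbSum G ℓ v ≡ sum F × (∀ w → Adj G v w → F w ≡ ℓ w) × (∀ w → ¬ Adj G v w → F w ≡ + 0)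
nbSum-summand G ℓ v = F , nbSum≡sum , on , off
  where
  -- The summand of nbSum is local to its definition in Defs; it is named through
  -- the defining equation so that its values can be computed by case analysis.
  exposed : ∃[ F ] nbSum G ℓ v ≡ List.foldr _+_ (+ 0) (map F (allFin (V G)))
  exposed = _ , refl
  F : Fin (V G) → ℤ
  F = proj₁ exposed
  nbSum≡sum : nbSum G ℓ v ≡ sum F
  nbSum≡sum = trans (proj₂ exposed)
    (trans (cong (List.foldr _+_ (+ 0)) (map-tabulate id F)) (foldr-tabulate _+_ (+ 0) F))
  on : ∀ w → Adj G v w → F w ≡ ℓ w
  on w adj with Adj? G v w
  ... | yes _    = refl
  ... | no ¬adj  = ⊥-elim (¬adj adj)
  off : ∀ w → ¬ Adj G v w → F w ≡ + 0
  off w ¬adj with Adj? G v w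
  ... | yes adj = ⊥-elim (¬adj adj)
  ... | no _    = refl

nbSum-K : ∀ {m} (ℓ : Labeling (K m)) v → nbSum (K m) ℓ v ≡ sum ℓ - ℓ v
nbSum-K {ℕ.suc m} ℓ v with nbSum-summand (K (ℕ.suc m)) ℓ v
... | F , nbSum≡sum , on , off = begin
  nbSum (K (ℕ.suc m)) ℓ v  ≡⟨ nbSum≡sum ⟩
  sum F                    ≡⟨ xyx⁻¹≈y (ℓ v) (sum F) ⟨
  ℓ v + sum F - ℓ v        ≡⟨ cong (_- ℓ v) (sum-punctured ℤ.+-0-commutativeMonoid ℓ F v F[v]≡0 on) ⟩
  sum ℓ - ℓ v              ∎
  where
  open ≡-Reasoning
  F[v]≡0 : F v ≡ + 0
  F[v]≡0 = off v (λ v≢v → v≢v refl)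

deduplicate-Unique : ∀ {a} {A : Set a} (_≟_ : DecidableEquality A) {xs : List A} →
                     Unique xs → deduplicate _≟_ xs ≡ xs
deduplicate-Unique _≟_ {[]}     []             = refl
deduplicate-Unique _≟_ {x ∷ xs} (x∉xs ∷ xs!) rewrite deduplicate-Unique _≟_ xs! =
  cong (x ∷_) (filter-all (¬? ∘ (x ≟_)) x∉xs)

order-injective : (G : Graph) (ℓ : Labeling G) → Injective _≡_ _≡_ ℓ → order G ℓ ≡ V G
order-injective G ℓ ℓ-injective = begin
  length (deduplicate ℤ._≟_ (map ℓ (allFin (V G))))
    ≡⟨ cong length (deduplicate-Unique ℤ._≟_ (map⁺ ℓ-injective (allFin⁺ (V G)))) ⟩
  length (map ℓ (allFin (V G)))  ≡⟨ length-map ℓ (allFin (V G)) ⟩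
  length (allFin (V G))          ≡⟨ length-tabulate id ⟩
  V G                            ∎
  where open ≡-Reasoning

proper-K⇒injective : ∀ {m} {ℓ : Labeling (K m)} → Proper (K m) ℓ → Injective _≡_ _≡_ ℓ
proper-K⇒injective proper {v} {w} ℓv≡ℓw = decidable-stable (v ≟ᶠ w) (λ v≢w → proper v w v≢w ℓv≡ℓw)

order-proper-K : ∀ {m} (ℓ : Labeling (K m)) → Proper (K m) ℓ → order (K m) ℓ ≡ m
order-proper-K {m} ℓ proper = order-injective (K m) ℓ (proper-K⇒injective proper)

pos-+-* : ∀ d x a → + (d ℕ.+ x ℕ.* a) ≡ + d + + x * + a
pos-+-* d x a = trans (ℤ.pos-+ d (x ℕ.* a)) (cong (λ z → + d + z) (ℤ.pos-* x a))

bézout-mod : ∀ a n → ∃[ x ] (+ a * x) ≡ + gcd a n [mod n ]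
bézout-mod a n = from-identity (ℕ.Bézout.identity (ℕ.gcd-GCD a n))
  where
  open ≡-mod-Reasoning n
  g = gcd a n
  *-neg-as-difference : ∀ a x d → a * - x ≡ d - (d + x * a)
  *-neg-as-difference = solve-∀
  from-identity : ℕ.Bézout.Identity g a n → ∃[ x ] (+ a * x) ≡ + g [mod n ]
  from-identity (ℕ.Bézout.+- x y g+yn≡xa) = + x , (begin
    + a * + x          ≡⟨ ℤ.*-comm (+ a) (+ x) ⟩
    + x * + a          ≡⟨ ℤ.pos-* x a ⟨
    + (x ℕ.* a)        ≡⟨ cong +_ g+yn≡xa ⟨
    + (g ℕ.+ y ℕ.* n)  ≡⟨ pos-+-* g y n ⟩
    + g + + y * + n    ≈⟨ +-multiple-mod (+ g) (+ y) ⟩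
    + g                ∎)
  from-identity (ℕ.Bézout.-+ x y g+xa≡yn) = - + x , (begin
    + a * - + x              ≡⟨ *-neg-as-difference (+ a) (+ x) (+ g) ⟩
    + g - (+ g + + x * + a)  ≡⟨ cong (λ z → + g - z) (pos-+-* g x a) ⟨
    + g - + (g ℕ.+ x ℕ.* a)  ≡⟨ cong (λ z → + g - + z) g+xa≡yn ⟩
    + g - + (y ℕ.* n)        ≡⟨ cong (λ z → + g - z) (ℤ.pos-* y n) ⟩
    + g - + y * + n          ≡⟨ cong (λ z → + g + z) (ℤ.neg-distribˡ-* (+ y) (+ n)) ⟩
    + g + (- + y) * + n      ≈⟨ +-multiple-mod (+ g) (- + y) ⟩
    + g                      ∎)

i-[i-j]≡j : ∀ i j → i - (i - j) ≡ j
i-[i-j]≡j = solve-∀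

solve-linear-congruence : ∀ a n {k} → + gcd a n ∣ k → ∃[ x ] (+ a * x) ≡ k [mod n ]
solve-linear-congruence a n {k} g∣k = x * t , (begin
  + a * (x * t)  ≡⟨ ℤ.*-assoc (+ a) x t ⟨
  + a * x * t    ≈⟨ *-congʳ-mod {a = + a * x} {b = + gcd a n} t ax≡g ⟩
  + gcd a n * t  ≡⟨ ℤ.*-comm (+ gcd a n) t ⟩
  t * + gcd a n  ≡⟨ k≡tg ⟨
  k              ∎)
  where
  open ≡-mod-Reasoning n
  open Signed._∣_ (Signed.∣ᵤ⇒∣ {+ gcd a n} {k} g∣k) renaming (quotient to t; equality to k≡tg)
  x : ℤ
  x = proj₁ (bézout-mod a n)
  ax≡g : (+ a * x) ≡ + gcd a n [mod n ]
  ax≡g = proj₂ (bézout-mod a n)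

linear-congruence⇒gcd∣ : ∀ a n {x k} → (+ a * x) ≡ k [mod n ] → + gcd a n ∣ k
linear-congruence⇒gcd∣ a n {x} {k} ax≡k =
  Signed.∣⇒∣ᵤ {+ gcd a n} {k}
    (subst (_ Signed.∣_) (i-[i-j]≡j (+ a * x) k) (Signed.∣m∣n⇒∣m-n g∣ax g∣ax-k))
  where
  g∣ax : + gcd a n Signed.∣ + a * x
  g∣ax = Signed.∣m⇒∣m*n x (Signed.∣ᵤ⇒∣ {+ gcd a n} {+ a} (ℕ.gcd[m,n]∣m a n))
  g∣ax-k : + gcd a n Signed.∣ + a * x - k
  g∣ax-k = Signed.∣-trans (Signed.∣ᵤ⇒∣ {+ gcd a n} {+ n} (ℕ.gcd[m,n]∣n a n)) (≡-mod⇒∣ (+ a * x) k ax≡k)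

nbSum-K-congruent : ∀ {M} (ℓ : Labeling (K (ℕ.suc M))) c → (∀ i → ℓ i ≡ c [mod n ]) →
                    ∀ v → nbSum (K (ℕ.suc M)) ℓ v ≡ (+ M * c) [mod n ]
nbSum-K-congruent {n = n} {M} ℓ c ℓ≡c v = begin
  nbSum (K (ℕ.suc M)) ℓ v      ≡⟨ nbSum-K ℓ v ⟩
  sum ℓ - ℓ v                  ≈⟨ minus-cong-mod {a = sum ℓ} {b = sum {ℕ.suc M} (λ _ → c)} {c = ℓ v} {d = c}
                                    (sum-cong-mod {f = ℓ} {g = λ _ → c} ℓ≡c) (ℓ≡c v) ⟩
  sum {ℕ.suc M} (λ _ → c) - c  ≡⟨ cong (_- c) (trans (sum-const (ℕ.suc M) c) (ℤ.suc-* (+ M) c)) ⟩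
  c + + M * c - c              ≡⟨ xyx⁻¹≈y c (+ M * c) ⟩
  + M * c                      ∎
  where open ≡-mod-Reasoning n

openColoring-K⇒congruent : ∀ {m} (ℓ : Labeling (K m)) → OpenColoring n k (K m) ℓ →
                           ∀ i j → ℓ i ≡ ℓ j [mod n ]
openColoring-K⇒congruent {n = n} {k = k} {m} ℓ open′ i j = begin
  ℓ i          ≈⟨ label≡sum-k i ⟩
  sum ℓ - k    ≈⟨ label≡sum-k j ⟨
  ℓ j          ∎
  where
  open ≡-mod-Reasoning n
  label≡sum-k : ∀ v → ℓ v ≡ sum ℓ - k [mod n ]
  label≡sum-k v = begin
    ℓ v                      ≡⟨ i-[i-j]≡j (sum ℓ) (ℓ v) ⟨
    sum ℓ - (sum ℓ - ℓ v)    ≡⟨ cong (λ z → sum ℓ - z) (nbSum-K ℓ v) ⟨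
    sum ℓ - nbSum (K m) ℓ v  ≈⟨ minus-cong-mod {a = sum ℓ} {b = sum ℓ} {c = nbSum (K m) ℓ v} {d = k}
                                  (≡-mod-refl (sum ℓ)) (open′ v) ⟩
    sum ℓ - k                ∎

progression : ∀ {m} → ℤ → ℕ → Fin m → ℤ
progression c n i = c + + toℕ i * + n

progression-injective : ∀ {m} c n .{{_ : ℕ.NonZero n}} → Injective _≡_ _≡_ (progression {m} c n)
progression-injective c n {i} {j} eq =
  toℕ-injective (ℤ.+-injective (ℤ.*-cancelʳ-≡ (+ toℕ i) (+ toℕ j) (+ n) (∙-cancelˡ c _ _ eq)))

progression-≡-mod : ∀ {m} c n (i : Fin m) → progression c n i ≡ c [mod n ]
progression-≡-mod c n i = +-multiple-mod c (+ toℕ i)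

linear-congruence⇒χ≡-K : ∀ {M c} .{{_ : ℕ.NonZero n}} → (+ M * c) ≡ k [mod n ] →
                         χ≡ n k (K (ℕ.suc M)) (ℕ.suc M)
linear-congruence⇒χ≡-K {n = n} {k = k} {M} {c} Mc≡k =
  (ℓ , (proper , open′) , order-proper-K ℓ proper) , minimal
  where
  ℓ : Labeling (K (ℕ.suc M))
  ℓ = progression c n
  proper : Proper (K (ℕ.suc M)) ℓ
  proper v w v≢w ℓv≡ℓw = v≢w (progression-injective c n ℓv≡ℓw)
  open′ : OpenColoring n k (K (ℕ.suc M)) ℓ
  open′ v = begin
    nbSum (K (ℕ.suc M)) ℓ v  ≈⟨ nbSum-K-congruent ℓ c (progression-≡-mod c n) v ⟩
    + M * c                  ≈⟨ Mc≡k ⟩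
    k                        ∎
    where open ≡-mod-Reasoning n
  minimal : ∀ ℓ′ → ProperOpen n k (K (ℕ.suc M)) ℓ′ → ℕ.suc M ≤ order (K (ℕ.suc M)) ℓ′
  minimal ℓ′ (proper′ , _) = ≤-reflexive (≡.sym (order-proper-K ℓ′ proper′))

openColoring-K⇒linear-congruence : ∀ {M} (ℓ : Labeling (K (ℕ.suc M))) →
                                   OpenColoring n k (K (ℕ.suc M)) ℓ → (+ M * ℓ zero) ≡ k [mod n ]
openColoring-K⇒linear-congruence {n = n} {k = k} {M} ℓ open′ = begin
  + M * ℓ zero                 ≈⟨ nbSum-K-congruent ℓ (ℓ zero) labels≡ℓ₀ zero ⟨
  nbSum (K (ℕ.suc M)) ℓ zero   ≈⟨ open′ zero ⟩
  k                            ∎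
  where
  open ≡-mod-Reasoning n
  labels≡ℓ₀ : ∀ i → ℓ i ≡ ℓ zero [mod n ]
  labels≡ℓ₀ i = openColoring-K⇒congruent ℓ open′ i zero

theorem6p3 : (k : ℤ) (n m : ℕ) → 2 ≤ n → ¬ (k ≡ + 0 [mod n ]) → 2 ≤ m →
    ((+ gcd (m ∸ 1) n) ∣ k → χ≡ n k (K m) m)
    × (¬ ((+ gcd (m ∸ 1) n) ∣ k) → ¬ χExists n k (K m))
theorem6p3 k n@(ℕ.suc _) (ℕ.suc M) (ℕ.s≤s _) _ (ℕ.s≤s _) = existence , nonexistence
  where
  existence : + gcd M n ∣ k → χ≡ n k (K (ℕ.suc M)) (ℕ.suc M)
  existence g∣k = linear-congruence⇒χ≡-K (proj₂ (solve-linear-congruence M n g∣k))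

  nonexistence : ¬ (+ gcd M n ∣ k) → ¬ χExists n k (K (ℕ.suc M))
  nonexistence g∤k (ℓ , _ , open′) =
    g∤k (linear-congruence⇒gcd∣ M n (openColoring-K⇒linear-congruence ℓ open′))
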